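{- There are absolute constants $C_1,C_2>0$ such that for every pattern $P=p_0\dots p_{m-1}$ over $\Sigma\cup\{?\}$ containing exactly $d$ wildcards, there exists a partitioning of $[0,m-1]$ into nonempty consecutive integer intervals $\mathcal I=(I_0,I_1,\dots,I_k)$, ordered from left to right, with the following properties: (1) if $I=[i,j]\in\mathcal I$, then either $i=j$ and $p_i$ is a wildcard, or $p_i\dots p_j$ contains no wildcard; (2) $k\le C_1(d+\log m)$; (3) for each interval $I=[i,j]\in\mathcal I$ such that $p_i\dots p_j$ contains no wildcard and $|I|=j-i+1>1$, the prefix $p_0\dots p_{i-1}$ contains $|I|$ consecutive non-wildcard characters; (4) the set $\{\mu(0),\mu(1),\dots,\mu(k)\}$ has at most $C_2\log m$ elements (for $m\ge2$), where $\mu(x)=\max_{0\le y\le x}|I_y|$.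
   Context: $\Sigma$ is an alphabet and $?\notin\Sigma$ is a wildcard symbol. For an integer interval $I=[i,j]$, $|I|=j-i+1$. -}

module Defs where

open import Data.Nat using (ℕ; zero; suc; _+_; _⊔_; _<_; _≤_)
open import Data.Nat.Properties using (_≟_)
open import Data.List using (List; []; _∷_; [_]; take; drop; length; deduplicate)
open import Data.Nat.ListAction using (sum)
open import Data.List.Relation.Unary.All using (All)
open import Data.Maybe using (Maybe; just; nothing)
open import Data.Product using (_×_; _,_; ∃-syntax)
open import Data.Sum using (_⊎_)
open import Relation.Binary.PropositionalEquality using (_≡_)

-- A pattern over Σ ∪ {?} is a list of 'Maybe A'; 'nothing' is the wildcard '?',
-- 'just a' is the letter a ∈ Σ = A.  Positions are 0 .. m-1 with m = length P.

wildcards : {A : Set} → List (Maybe A) → ℕ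
wildcards [] = 0
wildcards (nothing ∷ xs) = suc (wildcards xs)
wildcards (just _ ∷ xs) = wildcards xs

IsLetter : {A : Set} → Maybe A → Set
IsLetter {A} c = ∃[ a ] (c ≡ just a)

NoWild : {A : Set} → List (Maybe A) → Set
NoWild xs = All IsLetter xs

slice : {A : Set} → ℕ → ℕ → List (Maybe A) → List (Maybe A)
slice i len P = take len (drop i P)

-- A partition of [0, m-1] into nonempty consecutive intervals, ordered left to
-- right, is given by the list of their lengths (each ≥ 1, summing to m).
IsPartition : ℕ → List ℕ → Set
IsPartition m L = All (0 <_) L × sum L ≡ m

-- the intervals as (start i, length |I|) pairs, I = [i, i + |I| - 1]
intervalsFrom : ℕ → List ℕ → List (ℕ × ℕ)
intervalsFrom s [] = []
intervalsFrom s (l ∷ ls) = (s , l) ∷ intervalsFrom (s + l) ls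

intervals : List ℕ → List (ℕ × ℕ)
intervals = intervalsFrom 0

Prop1 : {A : Set} → List (Maybe A) → ℕ × ℕ → Set
Prop1 P (i , len) = (len ≡ 1 × slice i 1 P ≡ [ nothing ]) ⊎ NoWild (slice i len P)

Prop3 : {A : Set} → List (Maybe A) → ℕ × ℕ → Set
Prop3 P (i , len) =
  NoWild (slice i len P) → 1 < len → ∃[ t ] (t + len ≤ i × NoWild (slice t len P))

prefixMaxFrom : ℕ → List ℕ → List ℕ
prefixMaxFrom acc [] = []
prefixMaxFrom acc (l ∷ ls) = (acc ⊔ l) ∷ prefixMaxFrom (acc ⊔ l) ls

prefixMax : List ℕ → List ℕ
prefixMax = prefixMaxFrom 0

distinctCount : List ℕ → ℕ
distinctCount xs = length (deduplicate _≟_ xs)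

-- Scan the pattern from left to right, keeping a power of two B = 2^e such that the part already
-- read contains B consecutive letters (B = 1 at the start, which property (3) does not need).
-- A wildcard is a piece of its own.  A maximal run of r letters is cut into B, B, 2B, 4B, ...
-- as long as these fit: each piece is at most as long as the letters before it in the run, or
-- than B, so property (3) holds, and the last of them becomes the new B.  What is left is shorter
-- than twice the last piece and is cut into at most two pieces no longer than it.  A run thus
-- costs at most four pieces plus one per doubling of B, and B never exceeds m, whence (2).  Every
-- piece is a power of two or no longer than an earlier piece (or than 1), so every prefix
-- maximum is a power of two at most m, whence (4).

module Submission where

open import Defs
open import Data.Nat using (ℕ; zero; suc; _+_; _*_; _∸_; _^_; _⊔_; _<_; _≤_; z≤n; s≤s; s≤s⁻¹; _≤?_)
open import Data.Nat.Properties
open import Data.Nat.Logarithm using (⌊log₂_⌋; ⌊log₂⌋-mono-≤; ⌊log₂[2^n]⌋≡n)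
open import Data.Nat.Solver using (module +-*-Solver)
open +-*-Solver using (solve; _:+_; _:*_; con; _:=_)
open import Data.Nat.ListAction using (sum)
open import Data.Nat.ListAction.Properties using (sum-++)
open import Data.Fin using (Fin)
open import Data.Fin.Properties using (injective⇒≤)
open import Data.List using (List; []; _∷_; [_]; _++_; take; drop; length; map; upTo; lookup)
open import Data.List.Properties using (length-++; length-map; length-upTo; take-take; take-drop; drop-drop; ++-identityʳ)
open import Data.List.Relation.Unary.All as All using (All; []; _∷_)
open import Data.List.Relation.Unary.All.Properties using (take⁺; drop⁺; ++⁺; map⁺)
open import Data.List.Relation.Unary.Any using (here; there; index)
open import Data.List.Relation.Unary.Any.Properties using (lookup-index)
open import Data.List.Relation.Unary.Unique.Propositional using (Unique)
open import Data.List.Relation.Unary.AllPairs as AllPairs using ()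
open import Data.List.Relation.Unary.Unique.DecPropositional.Properties _≟_ using (deduplicate-!)
open import Data.List.Relation.Binary.Subset.Propositional using (_⊆_)
open import Data.List.Membership.Propositional using (_∈_)
open import Data.List.Membership.Propositional.Properties using (∈-lookup; ∈-map⁺; ∈-upTo⁺; ∈-deduplicate⁻)
open import Data.Maybe using (Maybe; just; nothing)
open import Data.Product using (_×_; _,_; ∃-syntax; proj₁; proj₂; map₁)
open import Data.Sum using (_⊎_; inj₁; inj₂)
open import Relation.Nullary using (yes; no; ¬_; contradiction)
open import Relation.Binary.PropositionalEquality using (_≡_; refl; sym; trans; cong; subst; module ≡-Reasoning)

private
  variable
    X : Set
    Q : X → Set

length≤sum : ∀ {L} → All (0 <_) L → length L ≤ sum L
length≤sum [] = z≤n
length≤sum (l>0 ∷ ps) = +-mono-≤ l>0 (length≤sum ps)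

All-≤-sum : ∀ L → All (_≤ sum L) L
All-≤-sum [] = []
All-≤-sum (l ∷ ls) = m≤m+n l (sum ls) ∷ All.map (λ le → ≤-trans le (m≤n+m (sum ls) l)) (All-≤-sum ls)

≤⊔⇒≤⊎≤ : ∀ {x} y z → x ≤ y ⊔ z → x ≤ y ⊎ x ≤ z
≤⊔⇒≤⊎≤ y z h with ⊔-sel y z
... | inj₁ eq = inj₁ (subst (_ ≤_) eq h)
... | inj₂ eq = inj₂ (subst (_ ≤_) eq h)

All-take-drop : ∀ {xs : List X} {r} a n → All Q (take r xs) → a + n ≤ r → All Q (take n (drop a xs))
All-take-drop {Q = Q} {xs = xs} {r} a n h le =
  subst (All Q) (sym (take-drop n a xs))
    (drop⁺ a (subst (All Q) (trans (take-take (a + n) r xs) (cong (λ k → take k xs) (m≤n⇒m⊓n≡m le)))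
                (take⁺ (a + n) h)))

All-take-suc : ∀ {y} {ys zs : List X} c → All Q (take c ys) → drop c ys ≡ y ∷ zs → Q y → All Q (take (suc c) ys)
All-take-suc zero [] refl qy = qy ∷ []
All-take-suc {ys = x ∷ ys} (suc c) (qx ∷ h) eq qy = qx ∷ All-take-suc c h eq qy

drop-next : ∀ i {y} {xs ys : List X} → drop i xs ≡ y ∷ ys → drop (suc i) xs ≡ ys
drop-next zero refl = refl
drop-next (suc i) {xs = _ ∷ xs} eq = drop-next i eq

Unique-lookup-injective : ∀ {xs : List X} {i j} → Unique xs → lookup xs i ≡ lookup xs j → i ≡ j
Unique-lookup-injective {xs = x ∷ xs} {Fin.zero}  {Fin.zero}  _ _ = refl
Unique-lookup-injective {xs = x ∷ xs} {Fin.zero}  {Fin.suc j} (x∉ AllPairs.∷ _) eq =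
  contradiction eq (All.lookup x∉ (∈-lookup j))
Unique-lookup-injective {xs = x ∷ xs} {Fin.suc i} {Fin.zero}  (x∉ AllPairs.∷ _) eq =
  contradiction (sym eq) (All.lookup x∉ (∈-lookup i))
Unique-lookup-injective {xs = x ∷ xs} {Fin.suc i} {Fin.suc j} (_ AllPairs.∷ u) eq =
  cong Fin.suc (Unique-lookup-injective u eq)

Unique-⊆⇒length≤ : ∀ {xs ys : List X} → Unique xs → xs ⊆ ys → length xs ≤ length ys
Unique-⊆⇒length≤ {xs = xs} {ys} u sub = injective⇒≤ {f = λ i → index (sub (∈-lookup i))} injective
  where
  injective : ∀ {i j} → index (sub (∈-lookup i)) ≡ index (sub (∈-lookup j)) → i ≡ j
  injective {i} {j} eq = Unique-lookup-injective u (begin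
    lookup xs i                            ≡⟨ lookup-index (sub (∈-lookup i)) ⟩
    lookup ys (index (sub (∈-lookup i)))   ≡⟨ cong (lookup ys) eq ⟩
    lookup ys (index (sub (∈-lookup j)))   ≡⟨ lookup-index (sub (∈-lookup j)) ⟨
    lookup xs j                            ∎)
    where open ≡-Reasoning

finish : ℕ → ℕ → List ℕ
finish B zero = []
finish B (suc r) with suc r ≤? B
... | yes _ = [ suc r ]
... | no _  = B ∷ [ suc r ∸ B ]

-- climb f e rem cuts rem letters that directly follow 2 ^ suc e letters of the same run;
-- f is fuel, enough when rem ≤ f.
climb : ℕ → ℕ → ℕ → List ℕ
climb zero    e rem = finish (2 ^ e) rem
climb (suc f) e rem with 2 ^ suc e ≤? rem
... | yes _ = 2 ^ suc e ∷ climb f (suc e) (rem ∸ 2 ^ suc e)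
... | no _  = finish (2 ^ e) rem

climbTop : ℕ → ℕ → ℕ → ℕ
climbTop zero    e rem = e
climbTop (suc f) e rem with 2 ^ suc e ≤? rem
... | yes _ = climbTop f (suc e) (rem ∸ 2 ^ suc e)
... | no _  = e

runPieces : ℕ → ℕ → List ℕ
runPieces e r with 2 ^ suc e ≤? r
... | yes _ = 2 ^ e ∷ 2 ^ e ∷ climb (r ∸ 2 ^ suc e) e (r ∸ 2 ^ suc e)
... | no _  = finish (2 ^ e) r

runTop : ℕ → ℕ → ℕ
runTop e r with 2 ^ suc e ≤? r
... | yes _ = climbTop (r ∸ 2 ^ suc e) e (r ∸ 2 ^ suc e)
... | no _  = e

-- scan e c xs: the part read so far contains 2 ^ e consecutive letters before the current run,
-- which has c letters so far.
scan : {A : Set} → ℕ → ℕ → List (Maybe A) → List ℕ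
scan e c []             = runPieces e c
scan e c (just _ ∷ xs)  = scan e (suc c) xs
scan e c (nothing ∷ xs) = runPieces e c ++ 1 ∷ scan (runTop e c) 0 xs

decompose : {A : Set} → List (Maybe A) → List ℕ
decompose = scan 0 0

2^>0 : ∀ e → 0 < 2 ^ e
2^>0 = m^n>0 2

2^suc : ∀ e → 2 ^ suc e ≡ 2 ^ e + 2 ^ e
2^suc e = cong (2 ^ e +_) (+-identityʳ (2 ^ e))

≰2^suc : ∀ {e r} → ¬ (2 ^ suc e ≤ r) → r ≤ 2 ^ e + 2 ^ e
≰2^suc {e} {r} ¬p = subst (r ≤_) (2^suc e) (<⇒≤ (≰⇒> ¬p))

fuel-step : ∀ {k rem f} → 0 < k → rem ≤ suc f → rem ∸ k ≤ f
fuel-step {k} {rem} k>0 le = ≤-trans (∸-monoʳ-≤ rem k>0) (∸-monoˡ-≤ 1 le)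

2^≤⇒≤⌊log₂⌋ : ∀ {k n} → 2 ^ k ≤ n → k ≤ ⌊log₂ n ⌋
2^≤⇒≤⌊log₂⌋ {k} le = subst (_≤ _) (⌊log₂[2^n]⌋≡n k) (⌊log₂⌋-mono-≤ le)

⌊log₂1⊔n⌋ : ∀ n → ⌊log₂ (1 ⊔ n) ⌋ ≡ ⌊log₂ n ⌋
⌊log₂1⊔n⌋ zero    = refl
⌊log₂1⊔n⌋ (suc n) = refl

IsPartition-cast : ∀ {m n L} → m ≡ n → IsPartition m L → IsPartition n L
IsPartition-cast refl p = p

IsPartition-∷ : ∀ {l n ls} → 0 < l → IsPartition n ls → IsPartition (l + n) (l ∷ ls)
IsPartition-∷ l>0 (ps , refl) = l>0 ∷ ps , refl

IsPartition-++ : ∀ {m n xs ys} → IsPartition m xs → IsPartition n ys → IsPartition (m + n) (xs ++ ys)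
IsPartition-++ {xs = xs} {ys} (pxs , refl) (pys , refl) = ++⁺ pxs pys , sum-++ xs ys

finish-partition : ∀ {B} → 0 < B → ∀ rem → IsPartition rem (finish B rem)
finish-partition B>0 zero = [] , refl
finish-partition {B} B>0 (suc r) with suc r ≤? B
... | yes _ = (s≤s z≤n ∷ []) , +-identityʳ (suc r)
... | no ¬p = (B>0 ∷ m<n⇒0<n∸m (≰⇒> ¬p) ∷ []) ,
              trans (cong (B +_) (+-identityʳ _)) (m+[n∸m]≡n (<⇒≤ (≰⇒> ¬p)))

climb-partition : ∀ f e rem → rem ≤ f → IsPartition rem (climb f e rem)
climb-partition zero    e rem le = finish-partition (2^>0 e) rem
climb-partition (suc f) e rem le with 2 ^ suc e ≤? rem
... | yes p = IsPartition-cast (m+[n∸m]≡n p)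
                (IsPartition-∷ (2^>0 (suc e))
                  (climb-partition f (suc e) (rem ∸ 2 ^ suc e) (fuel-step (2^>0 (suc e)) le)))
... | no _  = finish-partition (2^>0 e) rem

runPieces-partition : ∀ e r → IsPartition r (runPieces e r)
runPieces-partition e r with 2 ^ suc e ≤? r
... | yes p = IsPartition-cast eq
                (IsPartition-∷ (2^>0 e) (IsPartition-∷ (2^>0 e)
                  (climb-partition (r ∸ 2 ^ suc e) e (r ∸ 2 ^ suc e) ≤-refl)))
  where
  eq : 2 ^ e + (2 ^ e + (r ∸ 2 ^ suc e)) ≡ r
  eq = trans (sym (+-assoc (2 ^ e) _ _)) (trans (cong (_+ (r ∸ 2 ^ suc e)) (sym (2^suc e))) (m+[n∸m]≡n p))
... | no _  = finish-partition (2^>0 e) r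

scan-partition : ∀ {A : Set} e c (xs : List (Maybe A)) → IsPartition (c + length xs) (scan e c xs)
scan-partition e c [] = IsPartition-cast (sym (+-identityʳ c)) (runPieces-partition e c)
scan-partition e c (just _ ∷ xs) =
  IsPartition-cast (sym (+-suc c _)) (scan-partition e (suc c) xs)
scan-partition e c (nothing ∷ xs) =
  IsPartition-++ (runPieces-partition e c) (IsPartition-∷ (s≤s z≤n) (scan-partition (runTop e c) 0 xs))

finish-length : ∀ B rem → length (finish B rem) ≤ 2
finish-length B zero = z≤n
finish-length B (suc r) with suc r ≤? B
... | yes _ = s≤s z≤n
... | no _  = ≤-refl

climb-length : ∀ f e rem → length (climb f e rem) + e ≤ 2 + climbTop f e rem
climb-length zero    e rem = +-monoˡ-≤ e (finish-length (2 ^ e) rem)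
climb-length (suc f) e rem with 2 ^ suc e ≤? rem
... | yes _ = subst (_≤ 2 + climbTop f (suc e) (rem ∸ 2 ^ suc e)) (+-suc _ e)
                (climb-length f (suc e) (rem ∸ 2 ^ suc e))
... | no _  = +-monoˡ-≤ e (finish-length (2 ^ e) rem)

runPieces-length : ∀ e r → length (runPieces e r) + e ≤ 4 + runTop e r
runPieces-length e r with 2 ^ suc e ≤? r
... | yes _ = s≤s (s≤s (climb-length (r ∸ 2 ^ suc e) e (r ∸ 2 ^ suc e)))
... | no _  = +-monoˡ-≤ e (≤-trans (finish-length (2 ^ e) r) (m≤m+n 2 2))

climbTop-bound : ∀ f e rem → 2 ^ climbTop f e rem ≤ 2 ^ e ⊔ rem
climbTop-bound zero    e rem = m≤m⊔n _ rem
climbTop-bound (suc f) e rem with 2 ^ suc e ≤? rem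
... | yes p = ≤-trans (climbTop-bound f (suc e) (rem ∸ 2 ^ suc e))
                (≤-trans (⊔-lub p (m∸n≤m rem (2 ^ suc e))) (m≤n⊔m _ rem))
... | no _  = m≤m⊔n _ rem

runTop-bound : ∀ e r → 2 ^ runTop e r ≤ 2 ^ e ⊔ r
runTop-bound e r with 2 ^ suc e ≤? r
... | yes _ = ≤-trans (climbTop-bound (r ∸ 2 ^ suc e) e (r ∸ 2 ^ suc e))
                (⊔-monoʳ-≤ (2 ^ e) (m∸n≤m r (2 ^ suc e)))
... | no _  = m≤m⊔n _ r

count-step : ∀ a b e e₁ e' w → a + e ≤ 4 + e₁ → b + e₁ ≤ 4 + 5 * w + e' →
             a + (1 + b) + e ≤ 4 + 5 * (1 + w) + e'
count-step a b e e₁ e' w h₁ h₂ = begin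
  a + (1 + b) + e       ≡⟨ solve 3 (λ a b e → a :+ (con 1 :+ b) :+ e := (a :+ e) :+ (con 1 :+ b)) refl a b e ⟩
  (a + e) + (1 + b)     ≤⟨ +-monoˡ-≤ (1 + b) h₁ ⟩
  4 + e₁ + (1 + b)      ≡⟨ solve 2 (λ e₁ b → con 4 :+ e₁ :+ (con 1 :+ b) := con 5 :+ (b :+ e₁)) refl e₁ b ⟩
  5 + (b + e₁)          ≤⟨ +-monoʳ-≤ 5 h₂ ⟩
  5 + (4 + 5 * w + e')  ≡⟨ solve 2 (λ w e' → con 5 :+ (con 4 :+ con 5 :* w :+ e')
                                            := con 4 :+ con 5 :* (con 1 :+ w) :+ e') refl w e' ⟩
  4 + 5 * (1 + w) + e'  ∎
  where open ≤-Reasoning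

top-step : ∀ {x y z} c n → x ≤ y ⊔ n → y ≤ z ⊔ c → x ≤ z ⊔ (c + suc n)
top-step {z = z} c n h₁ h₂ =
  ≤-trans h₁ (⊔-lub (≤-trans h₂ (⊔-monoʳ-≤ z (m≤m+n c _)))
                    (≤-trans (≤-trans (n≤1+n n) (m≤n+m (suc n) c)) (m≤n⊔m z _)))

scan-length : ∀ {A : Set} e c (xs : List (Maybe A)) →
  ∃[ e' ] (length (scan e c xs) + e ≤ 4 + 5 * wildcards xs + e' × 2 ^ e' ≤ 2 ^ e ⊔ (c + length xs))
scan-length e c [] = runTop e c , runPieces-length e c ,
  ≤-trans (runTop-bound e c) (≤-reflexive (cong (2 ^ e ⊔_) (sym (+-identityʳ c))))
scan-length e c (just _ ∷ xs) with scan-length e (suc c) xs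
... | e' , h , b = e' , h , ≤-trans b (≤-reflexive (cong (2 ^ e ⊔_) (sym (+-suc c (length xs)))))
scan-length e c (nothing ∷ xs) with scan-length (runTop e c) 0 xs
... | e' , h , b =
  e' ,
  subst (λ n → n + e ≤ _) (sym (length-++ (runPieces e c)))
    (count-step _ _ e _ e' _ (runPieces-length e c) h) ,
  top-step c _ b (runTop-bound e c)

count-bound : ∀ len w l → len ≤ 4 + 5 * w + l → 1 ≤ l → len ∸ 1 ≤ 5 * (w + l)
count-bound len w l h 1≤l = begin
  len ∸ 1            ≤⟨ m∸n≤m len 1 ⟩
  len                ≤⟨ h ⟩
  4 + 5 * w + l      ≤⟨ +-monoˡ-≤ l (+-monoˡ-≤ (5 * w) (*-monoʳ-≤ 4 1≤l)) ⟩
  4 * l + 5 * w + l  ≡⟨ solve 2 (λ w l → con 4 :* l :+ con 5 :* w :+ l := con 5 :* (w :+ l)) refl w l ⟩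
  5 * (w + l)        ∎
  where open ≤-Reasoning

Pow2OrZero : ℕ → Set
Pow2OrZero x = x ≡ 0 ⊎ ∃[ k ] x ≡ 2 ^ k

≤1⇒pow2OrZero : ∀ {x} → x ≤ 1 → Pow2OrZero x
≤1⇒pow2OrZero x≤1 with n≤1⇒n≡0∨n≡1 x≤1
... | inj₁ refl = inj₁ refl
... | inj₂ refl = inj₂ (0 , refl)

⊔-pow2OrZero : ∀ {acc l} → Pow2OrZero acc → Pow2OrZero l ⊎ l ≤ acc ⊔ 1 → Pow2OrZero (acc ⊔ l)
⊔-pow2OrZero {acc} {l} pa (inj₁ pl) with ⊔-sel acc l
... | inj₁ eq = subst Pow2OrZero (sym eq) pa
... | inj₂ eq = subst Pow2OrZero (sym eq) pl
⊔-pow2OrZero {acc} {l} pa (inj₂ le) with ≤⊔⇒≤⊎≤ acc 1 le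
... | inj₁ l≤acc = subst Pow2OrZero (sym (m≥n⇒m⊔n≡m l≤acc)) pa
... | inj₂ l≤1   = ⊔-pow2OrZero pa (inj₁ (≤1⇒pow2OrZero l≤1))

-- B is the block size of the construction; it exceeds the running maximum acc only at the very
-- start, where B = 1 and acc = 0.
PowRecordsAbove : ℕ → List ℕ → Set
PowRecordsAbove B rest = ∀ {acc} → Pow2OrZero acc → B ≤ acc ⊔ 1 → All Pow2OrZero (prefixMaxFrom acc rest)

records-∷-small : ∀ {B l rest} → l ≤ B → PowRecordsAbove B rest → PowRecordsAbove B (l ∷ rest)
records-∷-small {l = l} l≤B k {acc} pa B≤ =
  pmax ∷ k pmax (≤-trans B≤ (⊔-monoˡ-≤ 1 (m≤m⊔n acc l)))
  where pmax = ⊔-pow2OrZero pa (inj₂ (≤-trans l≤B B≤))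

records-∷-pow : ∀ {B} j {rest} → PowRecordsAbove (2 ^ j) rest → PowRecordsAbove B (2 ^ j ∷ rest)
records-∷-pow j k {acc} pa _ =
  pmax ∷ k pmax (≤-trans (m≤n⊔m acc (2 ^ j)) (m≤m⊔n _ 1))
  where pmax = ⊔-pow2OrZero pa (inj₁ (inj₂ (j , refl)))

finish-records : ∀ {B rest} rem → rem ≤ B + B → PowRecordsAbove B rest → PowRecordsAbove B (finish B rem ++ rest)
finish-records zero le k = k
finish-records {B} (suc r) le k with suc r ≤? B
... | yes p = records-∷-small p k
... | no _  = records-∷-small ≤-refl (records-∷-small (m≤n+o⇒m∸n≤o (suc r) B le) k)

climb-records : ∀ {rest} f e rem → rem ≤ f →
  PowRecordsAbove (2 ^ climbTop f e rem) rest → PowRecordsAbove (2 ^ e) (climb f e rem ++ rest)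
climb-records zero    e .zero z≤n k = k
climb-records (suc f) e rem le k with 2 ^ suc e ≤? rem
... | yes _ = records-∷-pow (suc e) (climb-records f (suc e) (rem ∸ 2 ^ suc e) (fuel-step (2^>0 (suc e)) le) k)
... | no ¬p = finish-records rem (≰2^suc {e} ¬p) k

runPieces-records : ∀ {rest} e r →
  PowRecordsAbove (2 ^ runTop e r) rest → PowRecordsAbove (2 ^ e) (runPieces e r ++ rest)
runPieces-records e r k with 2 ^ suc e ≤? r
... | yes _ = records-∷-small ≤-refl (records-∷-small ≤-refl
                (climb-records (r ∸ 2 ^ suc e) e (r ∸ 2 ^ suc e) ≤-refl k))
... | no ¬p = finish-records r (≰2^suc {e} ¬p) k

scan-records : ∀ {A : Set} e c (xs : List (Maybe A)) → PowRecordsAbove (2 ^ e) (scan e c xs)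
scan-records e c [] = subst (PowRecordsAbove (2 ^ e)) (++-identityʳ (runPieces e c)) (runPieces-records e c (λ _ _ → []))
scan-records e c (just _ ∷ xs) = scan-records e (suc c) xs
scan-records e c (nothing ∷ xs) =
  runPieces-records e c (records-∷-small (2^>0 (runTop e c)) (scan-records (runTop e c) 0 xs))

Within : ℕ → ℕ × ℕ → Set
Within r (a , n) = a + n ≤ r

-- A piece of length n at offset a of a run can reuse the run's own first n letters when n ≤ a,
-- and otherwise needs n ≤ B, where B is the length of a wildcard-free block before the run.
Supported : ℕ → ℕ × ℕ → Set
Supported B (a , n) = n ≤ a ⊎ n ≤ B

intervalsFrom-within : ∀ k L → All (Within (k + sum L)) (intervalsFrom k L)
intervalsFrom-within k [] = []
intervalsFrom-within k (l ∷ ls) =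
  +-monoʳ-≤ k (m≤m+n l (sum ls)) ∷
  All.map (λ le → ≤-trans le (≤-reflexive (+-assoc k l (sum ls)))) (intervalsFrom-within (k + l) ls)

intervalsFrom-shift : ∀ s k L → intervalsFrom (s + k) L ≡ map (map₁ (s +_)) (intervalsFrom k L)
intervalsFrom-shift s k [] = refl
intervalsFrom-shift s k (l ∷ ls) =
  cong ((s + k , l) ∷_) (trans (cong (λ i → intervalsFrom i ls) (+-assoc s k l)) (intervalsFrom-shift s (k + l) ls))

intervalsFrom-++ : ∀ s xs ys → intervalsFrom s (xs ++ ys) ≡ intervalsFrom s xs ++ intervalsFrom (s + sum xs) ys
intervalsFrom-++ s [] ys = cong (λ i → intervalsFrom i ys) (sym (+-identityʳ s))
intervalsFrom-++ s (x ∷ xs) ys =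
  cong ((s , x) ∷_) (trans (intervalsFrom-++ (s + x) xs ys)
    (cong (λ i → intervalsFrom (s + x) xs ++ intervalsFrom i ys) (+-assoc s x (sum xs))))

Supported-mono : ∀ {B a n b m} → Supported B (a , n) → m ≤ n → a ≤ b → Supported B (b , m)
Supported-mono (inj₁ n≤a) m≤n a≤b = inj₁ (≤-trans m≤n (≤-trans n≤a a≤b))
Supported-mono (inj₂ n≤B) m≤n a≤b = inj₂ (≤-trans m≤n n≤B)

finish-supported : ∀ {B₀ B a} rem → Supported B₀ (a , B) → rem ≤ B + B →
                   All (Supported B₀) (intervalsFrom a (finish B rem))
finish-supported zero sp le = []
finish-supported {B = B} {a} (suc r) sp le with suc r ≤? B
... | yes p = Supported-mono sp p ≤-refl ∷ []
... | no _  = sp ∷ Supported-mono sp (m≤n+o⇒m∸n≤o (suc r) B le) (m≤m+n a B) ∷ []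

climb-supported : ∀ {B₀ a} f e rem → rem ≤ f → 2 ^ suc e ≤ a →
                  All (Supported B₀) (intervalsFrom a (climb f e rem))
climb-supported zero e .zero z≤n h = []
climb-supported {a = a} (suc f) e rem le h with 2 ^ suc e ≤? rem
... | yes _ = inj₁ h ∷ climb-supported f (suc e) (rem ∸ 2 ^ suc e) (fuel-step (2^>0 (suc e)) le)
                (subst (_≤ a + 2 ^ suc e) (sym (2^suc (suc e))) (+-monoˡ-≤ (2 ^ suc e) h))
... | no ¬p = finish-supported rem (inj₁ (≤-trans (m≤m+n (2 ^ e) _) h)) (≰2^suc {e} ¬p)

runPieces-supported : ∀ e r → All (Supported (2 ^ e)) (intervalsFrom 0 (runPieces e r))
runPieces-supported e r with 2 ^ suc e ≤? r
... | yes _ = inj₂ ≤-refl ∷ inj₂ ≤-refl ∷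
              climb-supported (r ∸ 2 ^ suc e) e (r ∸ 2 ^ suc e) ≤-refl (≤-reflexive (2^suc e))
... | no ¬p = finish-supported r (inj₂ ≤-refl) (≰2^suc {e} ¬p)

module _ {A : Set} (P : List (Maybe A)) where

  -- n ≤ 1 covers pieces of length one, for which property (3) asks nothing.
  BlockBefore : ℕ → ℕ → Set
  BlockBefore i n = n ≤ 1 ⊎ ∃[ t ] (t + n ≤ i × NoWild (slice t n P))

  Valid : ℕ × ℕ → Set
  Valid iv = Prop1 P iv × Prop3 P iv

  BlockBefore-mono : ∀ {i j n} → i ≤ j → BlockBefore i n → BlockBefore j n
  BlockBefore-mono i≤j (inj₁ n≤1) = inj₁ n≤1
  BlockBefore-mono i≤j (inj₂ (t , le , nw)) = inj₂ (t , ≤-trans le i≤j , nw)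

  BlockBefore-anti : ∀ {i m n} → m ≤ n → BlockBefore i n → BlockBefore i m
  BlockBefore-anti m≤n (inj₁ n≤1) = inj₁ (≤-trans m≤n n≤1)
  BlockBefore-anti {m = m} m≤n (inj₂ (t , le , nw)) =
    inj₂ (t , ≤-trans (+-monoʳ-≤ t m≤n) le , All-take-drop 0 m nw m≤n)

  slice-sub : ∀ {s r a n} → NoWild (slice s r P) → a + n ≤ r → NoWild (slice (s + a) n P)
  slice-sub {s} {a = a} {n} nw le = subst (λ ys → NoWild (take n ys)) (drop-drop s a P) (All-take-drop a n nw le)

  BlockBefore-run : ∀ {s r a n} → NoWild (slice s r P) → n ≤ r → n ≤ a → BlockBefore (s + a) n
  BlockBefore-run {s} {n = n} nw n≤r n≤a = inj₂ (s , +-monoʳ-≤ s n≤a , All-take-drop 0 n nw n≤r)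

  letter-valid : ∀ {i n} → NoWild (slice i n P) → BlockBefore i n → Valid (i , n)
  letter-valid nw (inj₁ n≤1)  = inj₂ nw , λ _ 1<n → contradiction n≤1 (<⇒≱ 1<n)
  letter-valid nw (inj₂ blk) = inj₂ nw , λ _ _ → blk

  run-valid : ∀ {s r B a n} → NoWild (slice s r P) → BlockBefore s B →
              Within r (a , n) → Supported B (a , n) → Valid (s + a , n)
  run-valid {s} {a = a} nw blk w (inj₁ n≤a) =
    letter-valid (slice-sub {s} nw w) (BlockBefore-run {s} nw (m+n≤o⇒n≤o a w) n≤a)
  run-valid {s} {a = a} nw blk w (inj₂ n≤B) =
    letter-valid (slice-sub {s} nw w) (BlockBefore-mono (m≤m+n s a) (BlockBefore-anti n≤B blk))

  runPieces-valid : ∀ e r s → NoWild (slice s r P) → BlockBefore s (2 ^ e) →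
                    All Valid (intervalsFrom s (runPieces e r))
  runPieces-valid e r s nw blk =
    subst (All Valid) (sym (trans (cong (λ i → intervalsFrom i (runPieces e r)) (sym (+-identityʳ s)))
                                  (intervalsFrom-shift s 0 (runPieces e r))))
      (map⁺ (All.map (λ (w , sp) → run-valid nw blk w sp) (All.zip (within , runPieces-supported e r))))
    where
    within : All (Within r) (intervalsFrom 0 (runPieces e r))
    within = subst (λ k → All (Within k) (intervalsFrom 0 (runPieces e r)))
                   (proj₂ (runPieces-partition e r)) (intervalsFrom-within 0 (runPieces e r))

  runTop-block : ∀ e r s → NoWild (slice s r P) → BlockBefore s (2 ^ e) → BlockBefore (s + r) (2 ^ runTop e r)
  runTop-block e r s nw blk with ≤⊔⇒≤⊎≤ (2 ^ e) r (runTop-bound e r)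
  ... | inj₁ ≤2^e = BlockBefore-mono (m≤m+n s r) (BlockBefore-anti ≤2^e blk)
  ... | inj₂ ≤r   = BlockBefore-run nw ≤r ≤r

  scan-valid : ∀ e c xs s → drop (s + c) P ≡ xs → NoWild (slice s c P) → BlockBefore s (2 ^ e) →
               All Valid (intervalsFrom s (scan e c xs))
  scan-valid e c [] s eq nw blk = runPieces-valid e c s nw blk
  scan-valid e c (just a ∷ xs) s eq nw blk =
    scan-valid e (suc c) xs s (subst (λ i → drop i P ≡ xs) (sym (+-suc s c)) (drop-next (s + c) eq))
      (All-take-suc c nw (trans (drop-drop s c P) eq) (a , refl)) blk
  scan-valid e c (nothing ∷ xs) s eq nw blk =
    subst (All Valid) (sym (intervalsFrom-++ s (runPieces e c) (1 ∷ scan e' 0 xs)))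
      (++⁺ (runPieces-valid e c s nw blk)
           (subst (λ i → All Valid (intervalsFrom (s + i) (1 ∷ scan e' 0 xs)))
                  (sym (proj₂ (runPieces-partition e c)))
                  (wildcard ∷ scan-valid e' 0 xs (s + c + 1) eq' [] blk')))
    where
    e' = runTop e c
    wildcard : Valid (s + c , 1)
    wildcard = inj₁ (refl , cong (take 1) eq) , λ { _ (s≤s ()) }
    eq' : drop (s + c + 1 + 0) P ≡ xs
    eq' = trans (cong (λ i → drop i P) (trans (+-identityʳ _) (+-comm (s + c) 1))) (drop-next (s + c) eq)
    blk' : BlockBefore (s + c + 1) (2 ^ e')
    blk' = BlockBefore-mono (m≤m+n (s + c) 1) (runTop-block e c s nw blk)

prefixMaxFrom-≤ : ∀ {n} acc L → acc ≤ n → All (_≤ n) L → All (_≤ n) (prefixMaxFrom acc L)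
prefixMaxFrom-≤ acc [] acc≤n [] = []
prefixMaxFrom-≤ acc (l ∷ ls) acc≤n (l≤n ∷ ls≤n) =
  ⊔-lub acc≤n l≤n ∷ prefixMaxFrom-≤ (acc ⊔ l) ls (⊔-lub acc≤n l≤n) ls≤n

distinctCount-≤ : ∀ {xs ys} → All (_∈ ys) xs → distinctCount xs ≤ length ys
distinctCount-≤ {xs} xs⊆ys =
  Unique-⊆⇒length≤ (deduplicate-! xs) (λ x∈ → All.lookup xs⊆ys (∈-deduplicate⁻ _≟_ xs x∈))

powersUpTo : ℕ → List ℕ
powersUpTo m = 0 ∷ map (2 ^_) (upTo (suc ⌊log₂ m ⌋))

length-powersUpTo : ∀ m → length (powersUpTo m) ≡ 2 + ⌊log₂ m ⌋
length-powersUpTo m = cong suc (trans (length-map (2 ^_) (upTo (suc ⌊log₂ m ⌋))) (length-upTo (suc ⌊log₂ m ⌋)))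

∈-powersUpTo : ∀ {x m} → Pow2OrZero x → x ≤ m → x ∈ powersUpTo m
∈-powersUpTo (inj₁ refl) _ = here refl
∈-powersUpTo (inj₂ (k , refl)) 2^k≤m = there (∈-map⁺ (2 ^_) (∈-upTo⁺ (s≤s (2^≤⇒≤⌊log₂⌋ {k} 2^k≤m))))

module _ {A : Set} (P : List (Maybe A)) where

  private
    m = length P
    D = decompose P

  decompose-partition : IsPartition m D
  decompose-partition = scan-partition 0 0 P

  decompose-valid : All (Valid P) (intervals D)
  decompose-valid = scan-valid P 0 0 P 0 refl [] (inj₁ ≤-refl)

  decompose-length-bound : length D ≤ 4 + 5 * wildcards P + ⌊log₂ m ⌋
  decompose-length-bound with scan-length 0 0 P
  ... | e' , h , b = ≤-trans (≤-reflexive (sym (+-identityʳ (length D))))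
                       (≤-trans h (+-monoʳ-≤ (4 + 5 * wildcards P) e'≤log))
    where
    e'≤log : e' ≤ ⌊log₂ m ⌋
    e'≤log = ≤-trans (2^≤⇒≤⌊log₂⌋ b) (≤-reflexive (⌊log₂1⊔n⌋ m))

  decompose-length : length D ∸ 1 ≤ 5 * (wildcards P + ⌊log₂ m ⌋)
  decompose-length with 2 ≤? m
  ... | yes 2≤m = count-bound (length D) (wildcards P) ⌊log₂ m ⌋ decompose-length-bound (⌊log₂⌋-mono-≤ 2≤m)
  ... | no 2≰m  = ≤-trans (∸-monoˡ-≤ 1 (≤-trans length≤m (s≤s⁻¹ (≰⇒> 2≰m)))) z≤n
    where
    length≤m : length D ≤ m
    length≤m = subst (length D ≤_) (proj₂ decompose-partition) (length≤sum (proj₁ decompose-partition))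

  decompose-distinct : 2 ≤ m → distinctCount (prefixMax D) ≤ 3 * ⌊log₂ m ⌋
  decompose-distinct 2≤m = begin
    distinctCount (prefixMax D)  ≤⟨ distinctCount-≤ (All.zipWith (λ (p , le) → ∈-powersUpTo p le) (pow , bounded)) ⟩
    length (powersUpTo m)        ≡⟨ length-powersUpTo m ⟩
    2 + ⌊log₂ m ⌋                ≤⟨ +-monoˡ-≤ ⌊log₂ m ⌋ (*-monoʳ-≤ 2 (⌊log₂⌋-mono-≤ 2≤m)) ⟩
    2 * ⌊log₂ m ⌋ + ⌊log₂ m ⌋    ≡⟨ +-comm (2 * ⌊log₂ m ⌋) _ ⟩
    3 * ⌊log₂ m ⌋                ∎
    where
    open ≤-Reasoning
    pow : All Pow2OrZero (prefixMax D)
    pow = scan-records 0 0 P (inj₁ refl) ≤-refl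
    bounded : All (_≤ m) (prefixMax D)
    bounded = prefixMaxFrom-≤ 0 D z≤n (subst (λ n → All (_≤ n) D) (proj₂ decompose-partition) (All-≤-sum D))

lemma9 : ∃[ C₁ ] ∃[ C₂ ] (0 < C₁ × 0 < C₂ ×
           ((A : Set) (P : List (Maybe A)) (d : ℕ) → wildcards P ≡ d →
             ∃[ L ] (IsPartition (length P) L
               × All (Prop1 P) (intervals L)
               × length L ∸ 1 ≤ C₁ * (d + ⌊log₂ length P ⌋)
               × All (Prop3 P) (intervals L)
               × (2 ≤ length P → distinctCount (prefixMax L) ≤ C₂ * ⌊log₂ length P ⌋))))
lemma9 = 5 , 3 , s≤s z≤n , s≤s z≤n , λ where
  A P .(wildcards P) refl →
    decompose P , decompose-partition P , All.map proj₁ (decompose-valid P) ,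
    decompose-length P , All.map proj₂ (decompose-valid P) , decompose-distinct P
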